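{- A DAG $G$ with no idle edges admits an ample framing if and only if $G$ is full.
   Context: A DAG is a finite directed acyclic graph, possibly with multiple edges. For a vertex $v$, $\mathrm{in}(v)$, $\mathrm{out}(v)$ are its incoming and outgoing edges; sources have no incoming edges, sinks no outgoing edges, all other vertices are inner. An edge is idle if it is the only incoming or the only outgoing edge of some inner vertex. $G$ is full if every inner vertex $v$ has $|\mathrm{in}(v)|=|\mathrm{out}(v)|=2$. A route is a maximal directed path (source to sink). A framing assigns to each inner vertex $v$ linear orders $\prec$ on $\mathrm{in}(v)$ and on $\mathrm{out}(v)$. For inner $v$, $\mathrm{In}(v)$/$\mathrm{Out}(v)$ are the directed paths from a source to $v$ / from $v$ to a sink; distinct $P,Q\in\mathrm{Out}(v)$ are compared by $P\prec Q$ iff, at the last vertex $w$ of their common initial segment, the edge of $P$ leaving $w$ precedes that of $Q$ in $\mathrm{out}(w)$; analogously for $\mathrm{In}(v)$ at the first vertex of their common final segment using $\mathrm{in}(w)$. For a route $R$ through $v$, $Rv$ and $vR$ are its parts before and after $v$. Routes $P,Q$ through a common inner vertex $v$ are in conflict at $v$ if, after possibly swapping them, $Pv\prec Qv$ and $vQ\prec vP$; they are coherent if not in conflict at any common inner vertex. A route is exceptional if coherent with all routes. With $\mathcal{F}_+(G)\subset\mathbb{R}^{E(G)}$ the cone of nonnegative flows (flow conservation at inner vertices) and $v_R$ the indicator vector of route $R$, a framing is ample if $\{v_R:R\text{ exceptional}\}$ lies in no facet of $\mathcal{F}_+(G)$ (equivalently, every non-idle edge lies on an exceptional route). -}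

module Defs where

open import Level using (0ℓ)
open import Data.Nat using (ℕ)
open import Data.Fin using (Fin; _≟_)
open import Data.List using (List; []; _∷_; _++_; [_]; length; filter; allFin)
open import Data.List.Membership.Propositional using (_∈_)
open import Data.Product using (Σ; ∃; ∃-syntax; _×_; _,_)
open import Data.Sum using (_⊎_)
open import Data.Empty using (⊥)
open import Relation.Nullary using (¬_)
open import Relation.Binary using (Rel; IsStrictTotalOrder)
open import Relation.Binary.PropositionalEquality using (_≡_; _≢_; refl)

record Multigraph : Set where
  field
    n m : ℕ
    src tgt : Fin m → Fin n

module _ (G : Multigraph) where
  open Multigraph G

  Vertex = Fin n
  Edge = Fin m

  data Path : Vertex → Vertex → List Edge → Set where
    nil  : ∀ {u} → Path u u []
    cons : ∀ {u v es} (e : Edge) → src e ≡ u → Path (tgt e) v es → Path u v (e ∷ es)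

  Acyclic : Set
  Acyclic = ∀ v e es → ¬ Path v v (e ∷ es)

record DAG : Set where
  field
    graph   : Multigraph
    acyclic : Acyclic graph
  open Multigraph graph public

module _ (G : DAG) where
  open DAG G

  Vtx = Fin n
  Edg = Fin m

  IsSource : Vtx → Set
  IsSource v = ∀ e → tgt e ≢ v

  IsSink : Vtx → Set
  IsSink v = ∀ e → src e ≢ v

  Inner : Vtx → Set
  Inner v = ¬ IsSource v × ¬ IsSink v

  indeg : Vtx → ℕ
  indeg v = length (filter (λ e → tgt e ≟ v) (allFin m))

  outdeg : Vtx → ℕ
  outdeg v = length (filter (λ e → src e ≟ v) (allFin m))

  Full : Set
  Full = ∀ v → Inner v → indeg v ≡ 2 × outdeg v ≡ 2

  Idle : Edg → Set
  Idle e = ∃[ v ] (Inner v ×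
             ((tgt e ≡ v × (∀ f → tgt f ≡ v → f ≡ e))
              ⊎ (src e ≡ v × (∀ f → src f ≡ v → f ≡ e))))

  InEdge : Vtx → Set
  InEdge v = Σ Edg (λ e → tgt e ≡ v)

  OutEdge : Vtx → Set
  OutEdge v = Σ Edg (λ e → src e ≡ v)

  -- A framing: linear (strict total) orders on in(v) and out(v) for every
  -- inner vertex v. (Relations are also given at non-inner vertices but are
  -- unconstrained there and never consulted.)
  record Framing : Set₁ where
    field
      inOrd  : (v : Vtx) → Rel (InEdge v) 0ℓ
      outOrd : (v : Vtx) → Rel (OutEdge v) 0ℓ
      inOrd-linear  : ∀ v → Inner v → IsStrictTotalOrder _≡_ (inOrd v)
      outOrd-linear : ∀ v → Inner v → IsStrictTotalOrder _≡_ (outOrd v)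

  -- Routes: maximal directed paths (source to sink), with at least one edge.
  Route : List Edg → Set
  Route R = ∃[ u ] ∃[ w ] (Path graph u w R × IsSource u × IsSink w × R ≢ [])

  -- R = A ++ B splits R at the vertex v:  A = Rv, B = vR.
  SplitAt : List Edg → Vtx → List Edg → List Edg → Set
  SplitAt R v A B =
    R ≡ A ++ B
    × (∃[ A₀ ] ∃[ e ] (A ≡ A₀ ++ [ e ] × tgt e ≡ v))
    × (∃[ f ] ∃[ B₀ ] (B ≡ f ∷ B₀ × src f ≡ v))

  module _ (F : Framing) where
    open Framing F

    -- order on paths ending at a common vertex: compare the two distinct edges
    -- entering the first vertex w of the common final segment C, in in(w)
    InPrec : List Edg → List Edg → Set
    InPrec P Q = ∃[ P' ] ∃[ Q' ] ∃[ p ] ∃[ q ] ∃[ C ]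
      (P ≡ P' ++ (p ∷ C) × Q ≡ Q' ++ (q ∷ C) ×
       Σ (tgt p ≡ tgt q) (λ h → inOrd (tgt q) (p , h) (q , refl)))

    -- order on paths starting at a common vertex: compare the two distinct
    -- edges leaving the last vertex w of the common initial segment C, in out(w)
    OutPrec : List Edg → List Edg → Set
    OutPrec P Q = ∃[ C ] ∃[ p ] ∃[ q ] ∃[ P' ] ∃[ Q' ]
      (P ≡ C ++ (p ∷ P') × Q ≡ C ++ (q ∷ Q') ×
       Σ (src p ≡ src q) (λ h → outOrd (src q) (p , h) (q , refl)))

    ConflictAt : List Edg → List Edg → Vtx → Set
    ConflictAt P Q v = ∃[ Pv ] ∃[ vP ] ∃[ Qv ] ∃[ vQ ]
      (SplitAt P v Pv vP × SplitAt Q v Qv vQ ×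
       ((InPrec Pv Qv × OutPrec vQ vP) ⊎ (InPrec Qv Pv × OutPrec vP vQ)))

    Coherent : List Edg → List Edg → Set
    Coherent P Q = ∀ v → Inner v → ¬ ConflictAt P Q v

    Exceptional : List Edg → Set
    Exceptional R = ∀ Q → Route Q → Coherent R Q

    Ample : Set
    Ample = ∀ e → ¬ Idle e → ∃[ R ] (Route R × Exceptional R × e ∈ R)

-- If the framing is ample, take an inner vertex v. Since no edge is idle, v has at least two
-- in-edges and two out-edges. Were there three in-edges x ≺ i ≺ y, the middle one would lie on
-- an exceptional route R leaving v along some o; for any other out-edge o′ the route through y
-- and o′ (if o′ ≺ o) or through x and o′ (if o ≺ o′) conflicts with R at v. Out-edges are dual.
--
-- Conversely, in a full DAG pairing the two in-edges, and the two out-edges, of every vertex gives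
-- two partial involutions on the edges. Their union only has alternating, hence even, cycles, so
-- the edges have a 2-colouring separating both pairings. Ordering the false edge before the true
-- one everywhere, a conflict needs a route carrying both colours, so monochromatic routes are
-- exceptional; and each edge extends, keeping its colour, to a monochromatic route.

module Submission where

open import Defs

open import Axiom.UniquenessOfIdentityProofs using (module Decidable⇒UIP)
open import Data.Bool as Bool using (Bool; true; false; not)
open import Data.Bool.Properties as Bool using (¬-not; not-¬; not-involutive)
open import Data.Empty using (⊥; ⊥-elim)
open import Data.Fin as Fin using (Fin; zero; suc; _≟_)
open import Data.Fin.Properties as Fin using (pigeonhole; any?)
open import Data.List using (List; []; _∷_; _++_; [_]; _∷ʳ_; reverse; filter; allFin; length; initLast; _∷ʳ′_)
open import Data.List.Properties using (unfold-reverse; ++-assoc; ++-conicalˡ; ++-conicalʳ)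
open import Data.List.Membership.Propositional using (_∈_; find)
open import Data.List.Membership.Propositional.Properties using (∈-∃++; ∈-filter⁺; ∈-filter⁻; ∈-allFin)
open import Data.List.Relation.Unary.All as All using (All; []; _∷_)
open import Data.List.Relation.Unary.All.Properties as All using ()
open import Data.List.Relation.Unary.AllPairs using ([]; _∷_)
open import Data.List.Relation.Unary.Any as Any using (Any; here; there)
open import Data.List.Relation.Unary.Any.Properties as Any using ()
open import Data.List.Relation.Unary.Unique.Propositional using (Unique)
import Data.List.Relation.Unary.Unique.Propositional.Properties as Unique
open import Data.Maybe using (Maybe; just; nothing; maybe; _>>=_)
open import Data.Maybe.Properties using (just-injective)
open import Data.Nat using (ℕ; zero; suc; z≤n; s≤s)
open import Data.Nat.Properties using (n<1+n)
open import Data.Product using (Σ; ∃₂; ∃-syntax; _×_; _,_; proj₁; proj₂)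
open import Data.Sum as Sum using (_⊎_; inj₁; inj₂)
open import Data.Unit using (⊤; tt)
open import Function using (_∘_; id; flip; case_of_)
open import Function.Bundles using (_⇔_; mk⇔)
open import Level using (0ℓ)
open import Relation.Binary using (Rel; IsStrictTotalOrder; DecidableEquality; tri<; tri≈; tri>)
open import Relation.Binary.Morphism using (IsOrderMonomorphism)
import Relation.Binary.Morphism.OrderMonomorphism as OrderMonomorphism
open import Relation.Binary.PropositionalEquality
  using (_≡_; _≢_; refl; sym; trans; cong; subst; subst₂; ≢-sym; module ≡-Reasoning)
open import Relation.Nullary using (¬_; Dec; yes; no; does; contradiction; ¬?)
open import Relation.Nullary.Decidable using (_×-dec_; _⊎-dec_; decidable-stable)

open ≡-Reasoning

All-reverse : ∀ {A : Set} {P : A → Set} {xs} → All P xs → All P (reverse xs)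
All-reverse pxs = All.tabulate (λ x∈ → All.lookup pxs (Any.reverse⁻ x∈))

length≡2 : ∀ {A : Set} {L : List A} {a b} → Unique L → a ∈ L → b ∈ L → a ≢ b →
           (∀ {x y z} → x ∈ L → y ∈ L → z ∈ L → x ≢ y → y ≢ z → x ≢ z → ⊥) → length L ≡ 2
length≡2 {L = []}         _ ()          _           _   _
length≡2 {L = _ ∷ []}     _ (here refl) (here refl) a≢b _ = contradiction refl a≢b
length≡2 {L = _ ∷ _ ∷ []} _ _           _           _   _ = refl
length≡2 {L = _ ∷ _ ∷ _ ∷ _} ((x≢y ∷ x≢z ∷ _) ∷ (y≢z ∷ _) ∷ _) _ _ _ no-three =
  ⊥-elim (no-three (here refl) (there (here refl)) (there (there (here refl))) x≢y y≢z x≢z)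

length≡2⇒pair : ∀ {A : Set} {L : List A} → length L ≡ 2 → ∃₂ λ a b → L ≡ a ∷ b ∷ []
length≡2⇒pair {L = a ∷ b ∷ []} refl = a , b , refl

module _ {A : Set} {_<_ : Rel A 0ℓ} (<-sto : IsStrictTotalOrder _≡_ _<_) where
  open IsStrictTotalOrder <-sto using (compare)

  betweenness-free⇒no-three-distinct : (∀ {a b c} → a < b → b < c → ⊥) →
                                        ∀ {x y z} → x ≢ y → y ≢ z → x ≢ z → ⊥
  betweenness-free⇒no-three-distinct no-between {x} {y} {z} x≢y y≢z x≢z
    with compare x y | compare y z | compare x z
  ... | tri≈ _ x≡y _ | _            | _            = x≢y x≡y
  ... | _            | tri≈ _ y≡z _ | _            = y≢z y≡z
  ... | _            | _            | tri≈ _ x≡z _ = x≢z x≡z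
  ... | tri< x<y _ _ | tri< y<z _ _ | _            = no-between x<y y<z
  ... | tri> _ _ y<x | tri> _ _ z<y | _            = no-between z<y y<x
  ... | tri< x<y _ _ | tri> _ _ z<y | tri< x<z _ _ = no-between x<z z<y
  ... | tri< x<y _ _ | tri> _ _ z<y | tri> _ _ z<x = no-between z<x x<y
  ... | tri> _ _ y<x | tri< y<z _ _ | tri< x<z _ _ = no-between y<x x<z
  ... | tri> _ _ y<x | tri< y<z _ _ | tri> _ _ z<x = no-between y<z z<x

pullback-isStrictTotalOrder : ∀ {A B : Set} {_<_ : Rel B 0ℓ} → IsStrictTotalOrder _≡_ _<_ →
                              (f : A → B) → (∀ {x y} → f x ≡ f y → x ≡ y) →
                              IsStrictTotalOrder _≡_ (λ x y → f x < f y)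
pullback-isStrictTotalOrder <-sto f f-injective = OrderMonomorphism.isStrictTotalOrder monomorphism <-sto
  where
  monomorphism : IsOrderMonomorphism _≡_ _≡_ _ _ f
  monomorphism = record
    { isOrderHomomorphism = record { cong = cong f ; mono = id }
    ; injective           = f-injective
    ; cancel              = id
    }

<-false-true : ∀ {u w} → u Bool.< w → u ≡ false × w ≡ true
<-false-true Bool.f<t = refl , refl

-- Two in/out pairs at a vertex cross when they are ordered oppositely, as for routes in conflict.
data Crossing {I O : Set} (_<ᴵ_ : Rel I 0ℓ) (_<ᴼ_ : Rel O 0ℓ) : Rel (I × O) 0ℓ where
  crosses-up   : ∀ {i o i′ o′} → i <ᴵ i′ → o′ <ᴼ o → Crossing _<ᴵ_ _<ᴼ_ (i , o) (i′ , o′)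
  crosses-down : ∀ {i o i′ o′} → i′ <ᴵ i → o <ᴼ o′ → Crossing _<ᴵ_ _<ᴼ_ (i , o) (i′ , o′)

module _ {I O : Set} {_<ᴵ_ : Rel I 0ℓ} {_<ᴼ_ : Rel O 0ℓ} where

  crossing-swap : ∀ {i o i′ o′} → Crossing _<ᴵ_ _<ᴼ_ (i , o) (i′ , o′) → Crossing _<ᴼ_ _<ᴵ_ (o , i) (o′ , i′)
  crossing-swap (crosses-up i<i′ o′<o)   = crosses-down o′<o i<i′
  crossing-swap (crosses-down i′<i o<o′) = crosses-up o<o′ i′<i

  uncrossed-interior⇒unique : IsStrictTotalOrder _≡_ _<ᴼ_ → ∀ {x i y o} →
                              (∀ p → ¬ Crossing _<ᴵ_ _<ᴼ_ (i , o) p) → x <ᴵ i → i <ᴵ y → ∀ o′ → o′ ≡ o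
  uncrossed-interior⇒unique <ᴼ-sto {x} {i} {y} {o} uncrossed x<i i<y o′
    with IsStrictTotalOrder.compare <ᴼ-sto o′ o
  ... | tri< o′<o _ _ = ⊥-elim (uncrossed (y , o′) (crosses-up i<y o′<o))
  ... | tri≈ _ o′≡o _ = o′≡o
  ... | tri> _ _ o<o′ = ⊥-elim (uncrossed (x , o′) (crosses-down x<i o<o′))

-- Two-colouring two partial involutions

module _ {A : Set} where

  PartialInvolution : (A → Maybe A) → Set
  PartialInvolution σ = ∀ x y → σ x ≡ just y → σ y ≡ just x × x ≢ y

  Separates : (A → Maybe A) → (A → Bool) → Set
  Separates σ c = ∀ x y → σ x ≡ just y → c x ≢ c y

module _ {A : Set} (_≟ᴬ_ : DecidableEquality A) where

  partner : List A → A → Maybe A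
  partner (a ∷ b ∷ []) e with a ≟ᴬ e | b ≟ᴬ e
  ... | yes _ | _     = just b
  ... | no _  | yes _ = just a
  ... | no _  | no _  = nothing
  partner _ _ = nothing

  partner-first : ∀ a b → partner (a ∷ b ∷ []) a ≡ just b
  partner-first a b with a ≟ᴬ a
  ... | yes _   = refl
  ... | no a≢a  = contradiction refl a≢a

  partner-second : ∀ {a b} → a ≢ b → partner (a ∷ b ∷ []) b ≡ just a
  partner-second {a} {b} a≢b with a ≟ᴬ b | b ≟ᴬ b
  ... | yes a≡b | _      = contradiction a≡b a≢b
  ... | no _    | yes _  = refl
  ... | no _    | no b≢b = contradiction refl b≢b

  partner-∈ : ∀ {L e f} → partner L e ≡ just f → f ∈ L
  partner-∈ {a ∷ b ∷ []} {e} eq with a ≟ᴬ e | b ≟ᴬ e | eq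
  ... | yes _ | _     | refl = there (here refl)
  ... | no _  | yes _ | refl = here refl

  partner-involution : ∀ {L} → Unique L → PartialInvolution (partner L)
  partner-involution {a ∷ b ∷ []} ((a≢b ∷ []) ∷ _) e f eq with a ≟ᴬ e | b ≟ᴬ e | eq
  ... | yes refl | _        | refl = partner-second a≢b , a≢b
  ... | no _     | yes refl | refl = partner-first a b , ≢-sym a≢b

-- Drop the σ-pair {x, y} and shortcut a –τ– x –σ– y –τ– b to a –τ⁻– b; a colouring separating
-- σ⁻ and τ⁻ then extends to x and y with opposite colours.
module Contraction {A : Set} (_≟ᴬ_ : DecidableEquality A) (σ τ : A → Maybe A)
  (σ-inv : PartialInvolution σ) (τ-inv : PartialInvolution τ) {x y : A} (σxy : σ x ≡ just y) where

  σyx : σ y ≡ just x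
  σyx = proj₁ (σ-inv x y σxy)

  x≢y : x ≢ y
  x≢y = proj₂ (σ-inv x y σxy)

  Endpoint : A → Set
  Endpoint e = e ≡ x ⊎ e ≡ y

  endpoint? : ∀ e → Dec (Endpoint e)
  endpoint? e = (e ≟ᴬ x) ⊎-dec (e ≟ᴬ y)

  Ends : A → A → Set
  Ends p q = (p ≡ x × q ≡ y) ⊎ (p ≡ y × q ≡ x)

  ends : ∀ {p q} → Endpoint p → Endpoint q → p ≢ q → Ends p q
  ends (inj₁ refl) (inj₁ refl) p≢q = contradiction refl p≢q
  ends (inj₁ refl) (inj₂ refl) _   = inj₁ (refl , refl)
  ends (inj₂ refl) (inj₁ refl) _   = inj₂ (refl , refl)
  ends (inj₂ refl) (inj₂ refl) p≢q = contradiction refl p≢q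

  σ⁻ : A → Maybe A
  σ⁻ e with endpoint? e
  ... | yes _ = nothing
  ... | no  _ = σ e

  shortcut : A → Maybe A
  shortcut z with z ≟ᴬ x | z ≟ᴬ y
  ... | yes _ | _     = τ y
  ... | no _  | yes _ = τ x
  ... | no _  | no _  = just z

  τ⁻ : A → Maybe A
  τ⁻ e with endpoint? e
  ... | yes _ = nothing
  ... | no  _ = τ e >>= shortcut

  other-end : ∀ {p} → Endpoint p → ∃[ q ] Ends p q
  other-end (inj₁ p≡x) = y , inj₁ (p≡x , refl)
  other-end (inj₂ p≡y) = x , inj₂ (p≡y , refl)

  ends-swap : ∀ {p q} → Ends p q → Ends q p
  ends-swap (inj₁ (p≡x , q≡y)) = inj₂ (q≡y , p≡x)
  ends-swap (inj₂ (p≡y , q≡x)) = inj₁ (q≡x , p≡y)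

  ends-distinct : ∀ {p q} → Ends p q → p ≢ q
  ends-distinct (inj₁ (refl , refl)) = x≢y
  ends-distinct (inj₂ (refl , refl)) = x≢y ∘ sym

  ends-endpointʳ : ∀ {p q} → Ends p q → Endpoint q
  ends-endpointʳ (inj₁ (_ , q≡y)) = inj₂ q≡y
  ends-endpointʳ (inj₂ (_ , q≡x)) = inj₁ q≡x

  ends-cover : ∀ {p q b} → Ends p q → Endpoint b → b ≡ p ⊎ b ≡ q
  ends-cover (inj₁ (refl , refl)) = id
  ends-cover (inj₂ (refl , refl)) = Sum.swap

  σ-ends : ∀ {a b} → Endpoint a → σ a ≡ just b → Ends a b
  σ-ends (inj₁ refl) σxb = inj₁ (refl , just-injective (trans (sym σxb) σxy))
  σ-ends (inj₂ refl) σyb = inj₂ (refl , just-injective (trans (sym σyb) σyx))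

  σ-endpoint-partner : ∀ {a b} → σ a ≡ just b → Endpoint b → Endpoint a
  σ-endpoint-partner {a} σab end-b with σ-ends end-b (proj₁ (σ-inv a _ σab))
  ... | inj₁ (_ , a≡y) = inj₂ a≡y
  ... | inj₂ (_ , a≡x) = inj₁ a≡x

  σ⁻-outer : ∀ {e} → ¬ Endpoint e → σ⁻ e ≡ σ e
  σ⁻-outer {e} ¬end with endpoint? e
  ... | yes end = contradiction end ¬end
  ... | no  _   = refl

  σ⁻-just : ∀ {e f} → σ⁻ e ≡ just f → ¬ Endpoint e × σ e ≡ just f
  σ⁻-just {e} σ⁻ef with endpoint? e | σ⁻ef
  ... | no ¬end | σef = ¬end , σef

  τ⁻-through : ∀ {a z} → ¬ Endpoint a → τ a ≡ just z → τ⁻ a ≡ shortcut z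
  τ⁻-through {a} ¬end τaz with endpoint? a
  ... | yes end = contradiction end ¬end
  ... | no  _ rewrite τaz = refl

  τ⁻-just : ∀ {e f} → τ⁻ e ≡ just f → ¬ Endpoint e × ∃[ z ] (τ e ≡ just z × shortcut z ≡ just f)
  τ⁻-just {e} τ⁻ef with endpoint? e | τ⁻ef
  ... | no ¬end | eq with τ e | eq
  ...   | just z | eq′ = ¬end , z , refl , eq′

  shortcut-outer : ∀ {z} → ¬ Endpoint z → shortcut z ≡ just z
  shortcut-outer {z} ¬end with z ≟ᴬ x | z ≟ᴬ y
  ... | yes z≡x | _       = contradiction (inj₁ z≡x) ¬end
  ... | no _    | yes z≡y = contradiction (inj₂ z≡y) ¬end
  ... | no _    | no _    = refl

  shortcut-end : ∀ {p q} → Ends p q → shortcut p ≡ τ q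
  shortcut-end (inj₁ (refl , refl)) with x ≟ᴬ x
  ... | yes _   = refl
  ... | no x≢x  = contradiction refl x≢x
  shortcut-end (inj₂ (refl , refl)) with y ≟ᴬ x | y ≟ᴬ y
  ... | yes y≡x | _      = contradiction (sym y≡x) x≢y
  ... | no _    | yes _  = refl
  ... | no _    | no y≢y = contradiction refl y≢y

  σ⁻-involution : PartialInvolution σ⁻
  σ⁻-involution a b σ⁻ab =
    let ¬end-a , σab = σ⁻-just σ⁻ab
        σba , a≢b    = σ-inv a b σab
    in  trans (σ⁻-outer (¬end-a ∘ σ-endpoint-partner σab)) σba , a≢b

  τ⁻-bypass : ∀ {a b p q} → ¬ Endpoint a → τ a ≡ just p → Ends p q → τ q ≡ just b →
              τ⁻ b ≡ just a × a ≢ b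
  τ⁻-bypass {a} {b} {p} {q} ¬end-a τap pq τqb =
    trans (τ⁻-through ¬end-b τbq) (trans (shortcut-end (ends-swap pq)) τpa) ,
    λ { refl → ends-distinct pq (just-injective (trans (sym τap) τbq)) }
    where
    τpa : τ p ≡ just a
    τpa = proj₁ (τ-inv a p τap)
    τbq : τ b ≡ just q
    τbq = proj₁ (τ-inv q b τqb)
    ¬end-b : ¬ Endpoint b
    ¬end-b end-b with ends-cover pq end-b
    ... | inj₁ refl = ¬end-a (subst Endpoint q≡a (ends-endpointʳ pq))
      where q≡a = just-injective (trans (sym (proj₁ (τ-inv q p τqb))) τpa)
    ... | inj₂ refl = proj₂ (τ-inv q q τqb) refl

  τ⁻-involution : PartialInvolution τ⁻
  τ⁻-involution a b τ⁻ab with τ⁻-just τ⁻ab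
  ... | ¬end-a , z , τaz , shortcut-zb with endpoint? z
  ...   | yes end-z =
    let q , zq = other-end end-z in τ⁻-bypass ¬end-a τaz zq (trans (sym (shortcut-end zq)) shortcut-zb)
  ...   | no ¬end-z with refl ← trans (sym (shortcut-outer ¬end-z)) shortcut-zb =
    let τba , a≢b = τ-inv a z τaz in trans (τ⁻-through ¬end-z τba) (shortcut-outer ¬end-a) , a≢b

  module Extend (c⁻ : A → Bool) (σ⁻-sep : Separates σ⁻ c⁻) (τ⁻-sep : Separates τ⁻ c⁻) where

    -- x must differ from its τ-partner and y from its own; when both partners lie outside {x, y}
    -- they are τ⁻-partners, so one choice serves both.
    cx : Bool
    cx = maybe (not ∘ c⁻) (maybe c⁻ true (τ y)) (τ x)

    c : A → Bool
    c e with e ≟ᴬ x | e ≟ᴬ y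
    ... | yes _ | _     = cx
    ... | no _  | yes _ = not cx
    ... | no _  | no _  = c⁻ e

    c-x : c x ≡ cx
    c-x with x ≟ᴬ x
    ... | yes _   = refl
    ... | no x≢x  = contradiction refl x≢x

    c-y : c y ≡ not cx
    c-y with y ≟ᴬ x | y ≟ᴬ y
    ... | yes y≡x | _      = contradiction (sym y≡x) x≢y
    ... | no _    | yes _  = refl
    ... | no _    | no y≢y = contradiction refl y≢y

    c-outer : ∀ {e} → ¬ Endpoint e → c e ≡ c⁻ e
    c-outer {e} ¬end with e ≟ᴬ x | e ≟ᴬ y
    ... | yes e≡x | _       = contradiction (inj₁ e≡x) ¬end
    ... | no _    | yes e≡y = contradiction (inj₂ e≡y) ¬end
    ... | no _    | no _    = refl

    c-ends : ∀ {p q} → Ends p q → c p ≢ c q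
    c-ends (inj₁ (refl , refl)) rewrite c-x | c-y = not-¬ refl
    c-ends (inj₂ (refl , refl)) rewrite c-x | c-y = ≢-sym (not-¬ refl)

    cx-from-y : ∀ {b} → τ y ≡ just b → ¬ Endpoint b → cx ≡ c⁻ b
    cx-from-y {b} τyb ¬end-b with τ x in τx
    ... | nothing rewrite τyb = refl
    ... | just a  = begin
      not (c⁻ a)       ≡⟨ cong not (¬-not (τ⁻-sep a b τ⁻ab)) ⟩
      not (not (c⁻ b)) ≡⟨ not-involutive (c⁻ b) ⟩
      c⁻ b             ∎
      where
      τax : τ a ≡ just x
      τax = proj₁ (τ-inv x a τx)
      ¬end-a : ¬ Endpoint a
      ¬end-a (inj₁ refl) = proj₂ (τ-inv x x τx) refl
      ¬end-a (inj₂ refl) = ¬end-b (inj₁ (just-injective (trans (sym τyb) τax)))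
      τ⁻ab : τ⁻ a ≡ just b
      τ⁻ab = trans (τ⁻-through ¬end-a τax) (trans (shortcut-end (inj₁ (refl , refl))) τyb)

    c-exit : ∀ {p b} → Endpoint p → τ p ≡ just b → ¬ Endpoint b → c p ≡ not (c⁻ b)
    c-exit (inj₁ refl) τxb _     = trans c-x (cong (maybe (not ∘ c⁻) (maybe c⁻ true (τ y))) τxb)
    c-exit (inj₂ refl) τyb ¬end-b = trans c-y (cong not (cx-from-y τyb ¬end-b))

    exit-separates : ∀ {p b} → Endpoint p → τ p ≡ just b → ¬ Endpoint b → c p ≢ c b
    exit-separates end-p τpb ¬end-b rewrite c-exit end-p τpb ¬end-b | c-outer ¬end-b = ≢-sym (not-¬ refl)

    σ-separates : Separates σ c
    σ-separates a b σab with endpoint? a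
    ... | yes end-a = c-ends (σ-ends end-a σab)
    ... | no ¬end-a =
      subst₂ _≢_ (sym (c-outer ¬end-a)) (sym (c-outer (¬end-a ∘ σ-endpoint-partner σab)))
        (σ⁻-sep a b (trans (σ⁻-outer ¬end-a) σab))

    τ-separates : Separates τ c
    τ-separates a b τab with endpoint? a | endpoint? b
    ... | yes end-a | yes end-b = c-ends (ends end-a end-b (proj₂ (τ-inv a b τab)))
    ... | yes end-a | no ¬end-b = exit-separates end-a τab ¬end-b
    ... | no ¬end-a | yes end-b = ≢-sym (exit-separates end-b (proj₁ (τ-inv a b τab)) ¬end-a)
    ... | no ¬end-a | no ¬end-b =
      subst₂ _≢_ (sym (c-outer ¬end-a)) (sym (c-outer ¬end-b))
        (τ⁻-sep a b (trans (τ⁻-through ¬end-a τab) (shortcut-outer ¬end-b)))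

module _ {A : Set} {_<_ : Rel A 0ℓ} (<-sto : IsStrictTotalOrder _≡_ _<_) where
  open IsStrictTotalOrder <-sto using (compare; _<?_; asym) renaming (_≟_ to _≟ᴬ_)

  precedes-partner : (A → Maybe A) → A → Bool
  precedes-partner τ x = maybe (λ y → does (x <? y)) true (τ x)

  precedes-disagree : ∀ {x y} → x ≢ y → does (x <? y) ≢ does (y <? x)
  precedes-disagree {x} {y} x≢y with x <? y | y <? x
  ... | yes x<y | yes y<x = λ _ → asym x<y y<x
  ... | yes _   | no _    = λ ()
  ... | no _    | yes _   = λ ()
  ... | no x≮y  | no y≮x  with compare x y
  ...   | tri< x<y _ _ = λ _ → x≮y x<y
  ...   | tri≈ _ x≡y _ = λ _ → x≢y x≡y
  ...   | tri> _ _ y<x = λ _ → y≮x y<x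

  precedes-partner-separates : ∀ τ → PartialInvolution τ → Separates τ (precedes-partner τ)
  precedes-partner-separates τ τ-inv x y τxy with τ-inv x y τxy
  ... | τyx , x≢y rewrite τxy | τyx = precedes-disagree x≢y

  separating-colouring-on : (L : List A) → ∀ σ τ → PartialInvolution σ → PartialInvolution τ →
                            (∀ x y → σ x ≡ just y → x ∈ L) → ∃[ c ] (Separates σ c × Separates τ c)
  separating-colouring-on [] σ τ _ τ-inv domain =
    precedes-partner τ , (λ x y σxy → case domain x y σxy of λ ()) , precedes-partner-separates τ τ-inv
  separating-colouring-on (x ∷ L) σ τ σ-inv τ-inv domain with σ x in σx
  ... | nothing = separating-colouring-on L σ τ σ-inv τ-inv domain′
    where
    domain′ : ∀ a b → σ a ≡ just b → a ∈ L
    domain′ a b σab with domain a b σab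
    ... | here refl = case trans (sym σx) σab of λ ()
    ... | there a∈L = a∈L
  ... | just y = c , σ-separates , τ-separates
    where
    open Contraction _≟ᴬ_ σ τ σ-inv τ-inv σx
    domain⁻ : ∀ a b → σ⁻ a ≡ just b → a ∈ L
    domain⁻ a b σ⁻ab with σ⁻-just σ⁻ab
    ... | ¬end-a , σab with domain a b σab
    ... | here a≡x  = contradiction (inj₁ a≡x) ¬end-a
    ... | there a∈L = a∈L
    contracted : ∃[ c ] (Separates σ⁻ c × Separates τ⁻ c)
    contracted = separating-colouring-on L σ⁻ τ⁻ σ⁻-involution τ⁻-involution domain⁻
    open Extend (proj₁ contracted) (proj₁ (proj₂ contracted)) (proj₂ (proj₂ contracted))

separating-colouring : ∀ {m} (σ τ : Fin m → Maybe (Fin m)) → PartialInvolution σ → PartialInvolution τ →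
                       ∃[ c ] (Separates σ c × Separates τ c)
separating-colouring {m} σ τ σ-inv τ-inv =
  separating-colouring-on Fin.<-isStrictTotalOrder (allFin m) σ τ σ-inv τ-inv (λ x _ _ → ∈-allFin x)

-- Paths, walks and routes

module _ {G : Multigraph} where
  open Multigraph G

  _++ᵖ_ : ∀ {u v w xs ys} → Path G u v xs → Path G v w ys → Path G u w (xs ++ ys)
  nil        ++ᵖ q = q
  cons e h p ++ᵖ q = cons e h (p ++ᵖ q)

  splitᵖ : ∀ xs {ys u w} → Path G u w (xs ++ ys) → ∃[ v ] (Path G u v xs × Path G v w ys)
  splitᵖ []       p            = _ , nil , p
  splitᵖ (x ∷ xs) (cons _ h p) = let v , p₁ , p₂ = splitᵖ xs p in v , cons x h p₁ , p₂

  []ᵖ-endpoints : ∀ {u w} → Path G u w [] → u ≡ w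
  []ᵖ-endpoints nil = refl

  edgeᵖ : ∀ e → Path G (src e) (tgt e) [ e ]
  edgeᵖ e = cons e refl nil

reverseᴹ : Multigraph → Multigraph
reverseᴹ G = record { n = n ; m = m ; src = tgt ; tgt = src }
  where open Multigraph G

reverseᵖ : ∀ {G u v es} → Path (reverseᴹ G) u v es → Path G v u (reverse es)
reverseᵖ          nil             = nil
reverseᵖ {G} {es = e ∷ es} (cons e refl p) =
  subst (Path G _ _) (sym (unfold-reverse e es)) (reverseᵖ p ++ᵖ edgeᵖ e)

reverseᴰ : DAG → DAG
reverseᴰ G = record { graph = reverseᴹ graph ; acyclic = acyclic-reverse }
  where
  open DAG G
  acyclic-reverse : Acyclic (reverseᴹ graph)
  acyclic-reverse v e es cycle =
    snoc-acyclic (reverse es) (subst (Path graph v v) (unfold-reverse e es) (reverseᵖ cycle))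
    where
    snoc-acyclic : ∀ xs → ¬ Path graph v v (xs ∷ʳ e)
    snoc-acyclic []       = acyclic v e []
    snoc-acyclic (x ∷ xs) = acyclic v x (xs ∷ʳ e)

module _ (G : DAG) where
  open DAG G

  _⇝⁺_ : Vtx G → Vtx G → Set
  u ⇝⁺ w = ∃₂ λ e es → Path graph u w (e ∷ es)

  Chain : ℕ → Vtx G → Set
  Chain k v = Σ (Fin (suc k) → Vtx G) λ f → f zero ≡ v × (∀ {i j} → i Fin.< j → f i ⇝⁺ f j)

  chain-cons : ∀ {k} e → Chain k (tgt e) → Chain (suc k) (src e)
  chain-cons {k} e (f , f₀ , reach) = f′ , refl , reach′
    where
    f′ : Fin (suc (suc k)) → Vtx G
    f′ zero    = src e
    f′ (suc i) = f i
    reach′ : ∀ {i j} → i Fin.< j → f′ i ⇝⁺ f′ j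
    reach′ {zero}  {suc zero}    _         =
      e , [] , subst (λ x → Path graph (src e) x [ e ]) (sym f₀) (edgeᵖ e)
    reach′ {zero}  {suc (suc j)} _         =
      let e′ , es , p = reach {zero} {suc j} (s≤s z≤n)
      in e , e′ ∷ es , cons e refl (subst (λ x → Path graph x _ _) f₀ p)
    reach′ {suc i} {suc j}       (s≤s i<j) = reach i<j

  no-long-chain : ∀ {v} → ¬ Chain n v
  no-long-chain (f , _ , reach) =
    let i , j , i<j , fᵢ≡fⱼ = pigeonhole (n<1+n n) f
        e , es , p = reach i<j
    in acyclic (f j) e es (subst (λ x → Path graph x (f j) (e ∷ es)) fᵢ≡fⱼ p)

  module _ (P : Edg G → Set) (Q : Vtx G → Set)
    (step : ∀ v → Q v → IsSink G v ⊎ ∃[ e ] (src e ≡ v × P e × Q (tgt e))) where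

    PathToSink : Vtx G → Set
    PathToSink v = ∃₂ λ w es → Path graph v w es × All P es × IsSink G w

    walk : ∀ k v → Q v → PathToSink v ⊎ Chain k v
    walk zero    v _ = inj₂ ((λ _ → v) , refl , λ { {zero} {zero} () })
    walk (suc k) v q with step v q
    ... | inj₁ sink                = inj₁ (v , [] , nil , [] , sink)
    ... | inj₂ (e , refl , pe , qe) with walk k (tgt e) qe
    ...   | inj₁ (w , es , p , pes , sink) = inj₁ (w , e ∷ es , cons e refl p , pe ∷ pes , sink)
    ...   | inj₂ chain                     = inj₂ (chain-cons e chain)

    extend-to-sink : ∀ v → Q v → PathToSink v
    extend-to-sink v q with walk n v q
    ... | inj₁ path  = path
    ... | inj₂ chain = ⊥-elim (no-long-chain chain)

module _ (G : DAG) where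
  open DAG G

  module _ (P : Edg G → Set) (Q⁻ Q⁺ : Vtx G → Set)
    (step⁻ : ∀ v → Q⁻ v → IsSource G v ⊎ ∃[ e ] (tgt e ≡ v × P e × Q⁻ (src e)))
    (step⁺ : ∀ v → Q⁺ v → IsSink G v ⊎ ∃[ e ] (src e ≡ v × P e × Q⁺ (tgt e))) where

    route-around : ∀ {u w es} → Path graph u w es → es ≢ [] → Q⁻ u → Q⁺ w →
                   ∃₂ λ A B → Route G (A ++ es ++ B) × All P A × All P B
    route-around {es = es} p es≢[] q⁻ q⁺ =
      let s , A , p⁻ , pA , source = extend-to-sink (reverseᴰ G) P Q⁻ step⁻ _ q⁻
          t , B , p⁺ , pB , sink   = extend-to-sink G P Q⁺ step⁺ _ q⁺
          nonempty = es≢[] ∘ ++-conicalˡ es B ∘ ++-conicalʳ (reverse A) (es ++ B)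
      in  reverse A , B , (s , t , reverseᵖ p⁻ ++ᵖ (p ++ᵖ p⁺) , source , sink , nonempty)
        , All-reverse pA , pB

  out-edge-or-sink : ∀ v → IsSink G v ⊎ ∃[ e ] src e ≡ v
  out-edge-or-sink v with any? (λ e → src e ≟ v)
  ... | yes edge = inj₂ edge
  ... | no ¬edge = inj₁ (λ e h → ¬edge (e , h))

  in-edge-or-source : ∀ v → IsSource G v ⊎ ∃[ e ] tgt e ≡ v
  in-edge-or-source v with any? (λ e → tgt e ≟ v)
  ... | yes edge = inj₂ edge
  ... | no ¬edge = inj₁ (λ e h → ¬edge (e , h))

  has-in-edge : ∀ {v} → ¬ IsSource G v → ∃[ e ] tgt e ≡ v
  has-in-edge {v} ¬source = Sum.[ flip contradiction ¬source , id ]′ (in-edge-or-source v)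

  has-out-edge : ∀ {v} → ¬ IsSink G v → ∃[ e ] src e ≡ v
  has-out-edge {v} ¬sink = Sum.[ flip contradiction ¬sink , id ]′ (out-edge-or-sink v)

  route-through : ∀ {x y} → tgt x ≡ src y → ∃₂ λ A B → Route G (A ++ x ∷ y ∷ B)
  route-through {x} {y} x→y =
    let A , B , route , _ = route-around (λ _ → ⊤) (λ _ → ⊤) (λ _ → ⊤) step⁻ step⁺
                              (cons x refl (cons y (sym x→y) nil)) (λ ()) tt tt
    in  A , B , route
    where
    step⁻ : ∀ v → ⊤ → IsSource G v ⊎ ∃[ e ] (tgt e ≡ v × ⊤ × ⊤)
    step⁻ v _ = Sum.map₂ (λ (e , h) → e , h , tt , tt) (in-edge-or-source v)
    step⁺ : ∀ v → ⊤ → IsSink G v ⊎ ∃[ e ] (src e ≡ v × ⊤ × ⊤)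
    step⁺ v _ = Sum.map₂ (λ (e , h) → e , h , tt , tt) (out-edge-or-sink v)

  route-continues : ∀ {R e v} → Route G R → e ∈ R → tgt e ≡ v → ¬ IsSink G v →
                    ∃₂ λ A B → Σ (OutEdge G v) λ o → R ≡ A ++ e ∷ proj₁ o ∷ B
  route-continues (_ , _ , p , _ , sink , _) e∈R refl ¬sink
    with A , B , refl ← ∈-∃++ e∈R | splitᵖ A p
  ... | _ , _ , cons _ _ nil          = contradiction sink ¬sink
  ... | _ , _ , cons _ _ (cons o h _) = A , _ , (o , h) , refl

  route-continues-back : ∀ {R e v} → Route G R → e ∈ R → src e ≡ v → ¬ IsSource G v →
                         ∃₂ λ A B → Σ (InEdge G v) λ i → R ≡ A ++ proj₁ i ∷ e ∷ B
  route-continues-back (_ , _ , p , source , _ , _) e∈R refl ¬source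
    with A , B , refl ← ∈-∃++ e∈R | splitᵖ A p
  ... | _ , pA , cons _ refl _ with initLast A
  ...   | []      with nil ← pA = contradiction source ¬source
  ...   | A′ ∷ʳ′ i with splitᵖ A′ pA
  ...     | _ , _ , cons _ _ p′ = A′ , B , (i , []ᵖ-endpoints p′) , ++-assoc A′ [ i ] (_ ∷ B)

module _ (G : DAG) where
  open DAG G

  edgesAt : (Edg G → Vtx G) → Vtx G → List (Edg G)
  edgesAt end v = filter (λ e → end e ≟ v) (allFin m)

  ∈-edgesAt⁺ : ∀ end {v e} → end e ≡ v → e ∈ edgesAt end v
  ∈-edgesAt⁺ end {v} {e} = ∈-filter⁺ (λ e → end e ≟ v) (∈-allFin e)

  ∈-edgesAt⁻ : ∀ end {v e} → e ∈ edgesAt end v → end e ≡ v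
  ∈-edgesAt⁻ end {v} e∈ = proj₂ (∈-filter⁻ (λ e → end e ≟ v) {xs = allFin m} e∈)

  edgesAt-unique : ∀ end v → Unique (edgesAt end v)
  edgesAt-unique end v = Unique.filter⁺ (λ e → end e ≟ v) (Unique.allFin⁺ m)

  degree-two : ∀ end {v} {_<_ : Rel (Σ (Edg G) λ e → end e ≡ v) 0ℓ} → IsStrictTotalOrder _≡_ _<_ →
               (∀ {a b c} → a < b → b < c → ⊥) → ∃[ e ] end e ≡ v →
               (∀ {e} → end e ≡ v → ∃[ e′ ] (end e′ ≡ v × e′ ≢ e)) → length (edgesAt end v) ≡ 2
  degree-two end <-sto no-between (a , a↦v) other =
    let b , b↦v , b≢a = other a↦v
    in  length≡2 (edgesAt-unique end _) (∈-edgesAt⁺ end a↦v) (∈-edgesAt⁺ end b↦v) (b≢a ∘ sym) no-three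
    where
    no-three : ∀ {x y z} → x ∈ edgesAt end _ → y ∈ edgesAt end _ → z ∈ edgesAt end _ →
               x ≢ y → y ≢ z → x ≢ z → ⊥
    no-three x∈ y∈ z∈ x≢y y≢z x≢z =
      betweenness-free⇒no-three-distinct <-sto no-between
        {_ , ∈-edgesAt⁻ end x∈} {_ , ∈-edgesAt⁻ end y∈} {_ , ∈-edgesAt⁻ end z∈}
        (x≢y ∘ cong proj₁) (y≢z ∘ cong proj₁) (x≢z ∘ cong proj₁)

-- Ample framings force fullness

module _ (G : DAG) (F : Framing G) where
  open DAG G
  open Framing F

  in-precedes-at : ∀ {v A A′} {i i′ : InEdge G v} → inOrd v i i′ →
                   InPrec G F (A ++ [ proj₁ i ]) (A′ ++ [ proj₁ i′ ])
  in-precedes-at {A = A} {A′} {e , h} {e′ , refl} i<i′ = A , A′ , e , e′ , [] , refl , refl , h , i<i′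

  out-precedes-at : ∀ {v B B′} {o o′ : OutEdge G v} → outOrd v o o′ →
                    OutPrec G F (proj₁ o ∷ B) (proj₁ o′ ∷ B′)
  out-precedes-at {B = B} {B′} {e , h} {e′ , refl} o<o′ = [] , e , e′ , B , B′ , refl , refl , h , o<o′

  split-at-junction : ∀ {v R A B} (i : InEdge G v) (o : OutEdge G v) → R ≡ A ++ proj₁ i ∷ proj₁ o ∷ B →
                      SplitAt G R v (A ++ [ proj₁ i ]) (proj₁ o ∷ B)
  split-at-junction {A = A} {B} (e , h) (f , h′) refl =
    sym (++-assoc A [ e ] (f ∷ B)) , (A , e , refl , h) , (f , B , refl , h′)

  crossing⇒conflict : ∀ {v R Q A B A′ B′} {i i′ : InEdge G v} {o o′ : OutEdge G v} →
                      R ≡ A ++ proj₁ i ∷ proj₁ o ∷ B → Q ≡ A′ ++ proj₁ i′ ∷ proj₁ o′ ∷ B′ →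
                      Crossing (inOrd v) (outOrd v) (i , o) (i′ , o′) → ConflictAt G F R Q v
  crossing⇒conflict {i = i} {i′} {o} {o′} R≡ Q≡ (crosses-up i<i′ o′<o) =
    _ , _ , _ , _ , split-at-junction i o R≡ , split-at-junction i′ o′ Q≡ ,
    inj₁ (in-precedes-at i<i′ , out-precedes-at o′<o)
  crossing⇒conflict {i = i} {i′} {o} {o′} R≡ Q≡ (crosses-down i′<i o<o′) =
    _ , _ , _ , _ , split-at-junction i o R≡ , split-at-junction i′ o′ Q≡ ,
    inj₂ (in-precedes-at i′<i , out-precedes-at o<o′)

  exceptional⇒uncrossed : ∀ {v R A B} → Exceptional G F R → Inner G v → (i : InEdge G v) (o : OutEdge G v) →
                          R ≡ A ++ proj₁ i ∷ proj₁ o ∷ B → ∀ p → ¬ Crossing (inOrd v) (outOrd v) (i , o) p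
  exceptional⇒uncrossed exceptional inner _ _ R≡ ((_ , i′→v) , (_ , v→o′)) crossing =
    let _ , _ , route = route-through G (trans i′→v (sym v→o′))
    in  exceptional _ route _ inner (crossing⇒conflict R≡ refl crossing)

module _ (G : DAG) (no-idle : ∀ e → ¬ Idle G e) where
  open DAG G

  other-in-edge : ∀ {v} → Inner G v → ∀ {e} → tgt e ≡ v → ∃[ e′ ] (tgt e′ ≡ v × e′ ≢ e)
  other-in-edge {v} inner {e} e→v with any? (λ f → tgt f ≟ v ×-dec ¬? (f ≟ e))
  ... | yes other = other
  ... | no ¬other = ⊥-elim (no-idle e (v , inner , inj₁ (e→v , only)))
    where only = λ f f→v → decidable-stable (f ≟ e) (λ f≢e → ¬other (f , f→v , f≢e))

  other-out-edge : ∀ {v} → Inner G v → ∀ {e} → src e ≡ v → ∃[ e′ ] (src e′ ≡ v × e′ ≢ e)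
  other-out-edge {v} inner {e} v→e with any? (λ f → src f ≟ v ×-dec ¬? (f ≟ e))
  ... | yes other = other
  ... | no ¬other = ⊥-elim (no-idle e (v , inner , inj₂ (v→e , only)))
    where only = λ f v→f → decidable-stable (f ≟ e) (λ f≢e → ¬other (f , v→f , f≢e))

  module _ (F : Framing G) (ample : Ample G F) where
    open Framing F

    squeezed-in-edge : ∀ {v} → Inner G v → ∀ {x i y} → inOrd v x i → inOrd v i y → ⊥
    squeezed-in-edge {v} inner {i = i@(e , e→v)} x<i i<y =
      let _ , route , exceptional , e∈R = ample e (no-idle e)
          _ , _ , o , R≡    = route-continues G route e∈R e→v (proj₂ inner)
          o′ , v→o′ , o′≢o = other-out-edge inner (proj₂ o)
          uncrossed         = exceptional⇒uncrossed G F exceptional inner i o R≡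
      in  o′≢o (cong proj₁ (uncrossed-interior⇒unique (outOrd-linear v inner) uncrossed x<i i<y (o′ , v→o′)))

    squeezed-out-edge : ∀ {v} → Inner G v → ∀ {x o y} → outOrd v x o → outOrd v o y → ⊥
    squeezed-out-edge {v} inner {o = o@(e , v→e)} x<o o<y =
      let _ , route , exceptional , e∈R = ample e (no-idle e)
          _ , _ , i , R≡    = route-continues-back G route e∈R v→e (proj₁ inner)
          i′ , i′→v , i′≢i = other-in-edge inner (proj₂ i)
          uncrossed         = λ (o′ , i′) →
            exceptional⇒uncrossed G F exceptional inner i o R≡ (i′ , o′) ∘ crossing-swap
      in  i′≢i (cong proj₁ (uncrossed-interior⇒unique (inOrd-linear v inner) uncrossed x<o o<y (i′ , i′→v)))

    ample⇒full : Full G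
    ample⇒full v inner =
      degree-two G tgt (inOrd-linear v inner) (squeezed-in-edge inner)
        (has-in-edge G (proj₁ inner)) (other-in-edge inner) ,
      degree-two G src (outOrd-linear v inner) (squeezed-out-edge inner)
        (has-out-edge G (proj₂ inner)) (other-out-edge inner)

-- The colour framing of a full DAG

module _ (G : DAG) where
  open DAG G

  sibling : (Edg G → Vtx G) → Edg G → Maybe (Edg G)
  sibling end e = partner _≟_ (edgesAt G end (end e)) e

  sibling-involution : ∀ end → PartialInvolution (sibling end)
  sibling-involution end e f eq =
    let same-end = ∈-edgesAt⁻ G end (partner-∈ _≟_ eq)
        f↦e , e≢f = partner-involution _≟_ (edgesAt-unique G end (end e)) e f eq
    in  subst (λ v → partner _≟_ (edgesAt G end v) f ≡ just e) (sym same-end) f↦e , e≢f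

  module _ (end : Edg G → Vtx G) (c : Edg G → Bool) (separates : Separates (sibling end) c)
           {v} (degree-two : length (edgesAt G end v) ≡ 2) where
    private
      pair : ∃₂ λ a b → edgesAt G end v ≡ a ∷ b ∷ []
      pair = length≡2⇒pair degree-two
      a b : Edg G
      a = proj₁ pair
      b = proj₁ (proj₂ pair)
      edges≡ : edgesAt G end v ≡ a ∷ b ∷ []
      edges≡ = proj₂ (proj₂ pair)

      ∈-pair : ∀ {e} → end e ≡ v → e ≡ a ⊎ e ≡ b
      ∈-pair e↦v with subst (_ ∈_) edges≡ (∈-edgesAt⁺ G end e↦v)
      ... | here e≡a         = inj₁ e≡a
      ... | there (here e≡b) = inj₂ e≡b

      a↦v : end a ≡ v
      a↦v = ∈-edgesAt⁻ G end (subst (a ∈_) (sym edges≡) (here refl))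

      b↦v : end b ≡ v
      b↦v = ∈-edgesAt⁻ G end (subst (b ∈_) (sym edges≡) (there (here refl)))

      ca≢cb : c a ≢ c b
      ca≢cb = separates a b (trans (cong (λ u → partner _≟_ (edgesAt G end u) a) a↦v)
                                   (trans (cong (λ L → partner _≟_ L a) edges≡) (partner-first _≟_ a b)))

    colour-surjective-at : ∀ k → ∃[ e ] (end e ≡ v × c e ≡ k)
    colour-surjective-at k with k Bool.≟ c a
    ... | yes k≡ca = a , a↦v , sym k≡ca
    ... | no k≢ca  = b , b↦v , trans (¬-not (≢-sym ca≢cb)) (sym (¬-not k≢ca))

    colour-injective-at : ∀ {e f} → end e ≡ v → end f ≡ v → c e ≡ c f → e ≡ f
    colour-injective-at e↦v f↦v ce≡cf with ∈-pair e↦v | ∈-pair f↦v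
    ... | inj₁ refl | inj₁ refl = refl
    ... | inj₁ refl | inj₂ refl = contradiction ce≡cf ca≢cb
    ... | inj₂ refl | inj₁ refl = contradiction (sym ce≡cf) ca≢cb
    ... | inj₂ refl | inj₂ refl = refl

module _ (G : DAG) (c : Edg G → Bool) (in-separates : Separates (sibling G (DAG.tgt G)) c)
         (out-separates : Separates (sibling G (DAG.src G)) c) (full : Full G) where
  open DAG G

  colour-order : ∀ {end : Edg G → Vtx G} {v} → Rel (Σ (Edg G) λ e → end e ≡ v) 0ℓ
  colour-order (e , _) (f , _) = c e Bool.< c f

  colour-order-linear : ∀ end → Separates (sibling G end) c → ∀ {v} → length (edgesAt G end v) ≡ 2 →
                        IsStrictTotalOrder _≡_ (colour-order {end} {v})
  colour-order-linear end separates degree-two =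
    pullback-isStrictTotalOrder Bool.<-isStrictTotalOrder (c ∘ proj₁) injective
    where
    injective : ∀ {e f} → c (proj₁ e) ≡ c (proj₁ f) → e ≡ f
    injective {_ , e↦v} {_ , f↦v} ce≡cf
      with refl ← colour-injective-at G end c separates degree-two e↦v f↦v ce≡cf =
      cong (_ ,_) (Decidable⇒UIP.≡-irrelevant _≟_ e↦v f↦v)

  colour-framing : Framing G
  colour-framing = record
    { inOrd         = λ _ → colour-order
    ; outOrd        = λ _ → colour-order
    ; inOrd-linear  = λ v inner → colour-order-linear tgt in-separates (proj₁ (full v inner))
    ; outOrd-linear = λ v inner → colour-order-linear src out-separates (proj₂ (full v inner))
    }

  in-precedes-colours : ∀ {P Q} → InPrec G colour-framing P Q →
                        Any (λ e → c e ≡ false) P × Any (λ e → c e ≡ true) Q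
  in-precedes-colours (P′ , Q′ , _ , _ , _ , refl , refl , _ , cp<cq) =
    let cp , cq = <-false-true cp<cq in Any.++⁺ʳ P′ (here cp) , Any.++⁺ʳ Q′ (here cq)

  out-precedes-colours : ∀ {P Q} → OutPrec G colour-framing P Q →
                         Any (λ e → c e ≡ false) P × Any (λ e → c e ≡ true) Q
  out-precedes-colours (C , _ , _ , _ , _ , refl , refl , _ , cp<cq) =
    let cp , cq = <-false-true cp<cq in Any.++⁺ʳ C (here cp) , Any.++⁺ʳ C (here cq)

  conflict⇒two-colours : ∀ {R Q v} → ConflictAt G colour-framing R Q v →
                         Any (λ e → c e ≡ false) R × Any (λ e → c e ≡ true) R
  conflict⇒two-colours (Pv , _ , _ , _ , (refl , _) , _ , inj₁ (Pv≺Qv , vQ≺vP)) =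
    Any.++⁺ˡ (proj₁ (in-precedes-colours Pv≺Qv)) , Any.++⁺ʳ Pv (proj₂ (out-precedes-colours vQ≺vP))
  conflict⇒two-colours (Pv , _ , _ , _ , (refl , _) , _ , inj₂ (Qv≺Pv , vP≺vQ)) =
    Any.++⁺ʳ Pv (proj₁ (out-precedes-colours vP≺vQ)) , Any.++⁺ˡ (proj₂ (in-precedes-colours Qv≺Pv))

  monochromatic⇒exceptional : ∀ {k R} → All (λ e → c e ≡ k) R → Exceptional G colour-framing R
  monochromatic⇒exceptional {k} {R} monochromatic _ _ _ _ conflict =
    let has-false , has-true = conflict⇒two-colours conflict
    in  contradiction (trans (sym (colour-of has-false)) (colour-of has-true)) λ ()
    where
    colour-of : ∀ {b} → Any (λ e → c e ≡ b) R → k ≡ b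
    colour-of any = let _ , e∈R , ce≡b = find any in trans (sym (All.lookup monochromatic e∈R)) ce≡b

  coloured-in-edge : ∀ {v} → Inner G v → ∀ k → ∃[ e ] (tgt e ≡ v × c e ≡ k)
  coloured-in-edge {v} inner = colour-surjective-at G tgt c in-separates (proj₁ (full v inner))

  coloured-out-edge : ∀ {v} → Inner G v → ∀ k → ∃[ e ] (src e ≡ v × c e ≡ k)
  coloured-out-edge {v} inner = colour-surjective-at G src c out-separates (proj₂ (full v inner))

  colour-framing-ample : Ample G colour-framing
  colour-framing-ample e _ =
    let A , B , route , A-mono , B-mono =
          route-around G (λ f → c f ≡ c e) (λ v → ¬ IsSink G v) (λ v → ¬ IsSource G v) step⁻ step⁺
            (edgeᵖ e) (λ ()) (λ sink → sink e refl) (λ source → source e refl)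
    in  A ++ e ∷ B , route , monochromatic⇒exceptional (All.++⁺ A-mono (refl ∷ B-mono)) ,
        Any.++⁺ʳ A (here refl)
    where
    step⁻ : ∀ v → ¬ IsSink G v → IsSource G v ⊎ ∃[ f ] (tgt f ≡ v × c f ≡ c e × ¬ IsSink G (src f))
    step⁻ v ¬sink with in-edge-or-source G v
    ... | inj₁ source     = inj₁ source
    ... | inj₂ (f , f→v) =
      let g , g→v , cg = coloured-in-edge ((λ source → source f f→v) , ¬sink) (c e)
      in  inj₂ (g , g→v , cg , λ sink → sink g refl)
    step⁺ : ∀ v → ¬ IsSource G v → IsSink G v ⊎ ∃[ f ] (src f ≡ v × c f ≡ c e × ¬ IsSource G (tgt f))
    step⁺ v ¬source with out-edge-or-sink G v
    ... | inj₁ sink       = inj₁ sink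
    ... | inj₂ (f , v→f) =
      let g , v→g , cg = coloured-out-edge (¬source , λ sink → sink f v→f) (c e)
      in  inj₂ (g , v→g , cg , λ source → source g refl)

full⇒ample : ∀ G → Full G → ∃[ F ] Ample G F
full⇒ample G full =
  let c , in-separates , out-separates =
        separating-colouring (sibling G tgt) (sibling G src) (sibling-involution G tgt) (sibling-involution G src)
  in  colour-framing G c in-separates out-separates full ,
      colour-framing-ample G c in-separates out-separates full
  where open DAG G

corollary3p14 : (G : DAG) → (∀ e → ¬ Idle G e) →
    (∃[ F ] Ample G F) ⇔ Full G
corollary3p14 G no-idle = mk⇔ (λ (F , ample) → ample⇒full G no-idle F ample) (full⇒ample G)
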